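{- Let $\varphi$ be an fPIL formula over $P$ and a De Morgan algebra $K$. Then (1) $\varphi\uplus\varphi\equiv\varphi$; (2) $\neg\sim\varphi\equiv\,!\varphi$; (3) $\neg\varphi\equiv\,\sim!\varphi$.
   Context: A De Morgan algebra $(K,\vee,\wedge,0,1,\overline{\cdot})$ is a bounded distributive lattice with bottom $0$, top $1$ and a map $k\mapsto\overline k$ with $\overline{\overline k}=k$ and the De Morgan laws. $P$ is a set of ports; a $K$-fuzzy interaction is $\alpha:P\to K$ with $\alpha(p)\ne0$ for some $p$; $fC(P,K)$ is the set of nonempty (finite) sets of $K$-fuzzy interactions. fPIL formulas: $\varphi::=true\mid p\mid\,!\varphi\mid\varphi\sqcup\varphi$ with $\|true\|(\alpha)=1$, $\|p\|(\alpha)=\alpha(p)$, $\|!\varphi\|(\alpha)=\overline{\|\varphi\|(\alpha)}$, $\|\varphi_1\sqcup\varphi_2\|(\alpha)=\|\varphi_1\|(\alpha)\vee\|\varphi_2\|(\alpha)$. fPCL formulas: $\zeta::=\varphi\mid\neg\zeta\mid\zeta\oplus\zeta\mid\zeta\uplus\zeta$, $\sim\zeta:=\zeta\uplus true$; for $\gamma\in fC(P,K)$: $\|\varphi\|(\gamma)=\bigwedge_{\alpha\in\gamma}\|\varphi\|(\alpha)$, $\|\neg\zeta\|(\gamma)=\overline{\|\zeta\|(\gamma)}$, $\|\zeta_1\oplus\zeta_2\|(\gamma)=\|\zeta_1\|(\gamma)\vee\|\zeta_2\|(\gamma)$, $\|\zeta_1\uplus\zeta_2\|(\gamma)=\bigvee_{\gamma_1,\gamma_2\in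 fC(P,K),\,\gamma_1\cup\gamma_2=\gamma}(\|\zeta_1\|(\gamma_1)\wedge\|\zeta_2\|(\gamma_2))$. $\zeta_1\equiv\zeta_2$ means $\|\zeta_1\|(\gamma)=\|\zeta_2\|(\gamma)$ for all $\gamma\in fC(P,K)$, for an arbitrary De Morgan algebra $K$. In (2) and (3), $!\varphi$ and $\sim!\varphi$ are interpreted with the fPCL (configuration) semantics. -}

module Defs where

open import Level using (Level; suc; _⊔_)
open import Data.Product using (Σ; _×_; _,_; ∃)
open import Data.List using (List; []; _∷_; foldr; map; concatMap)
open import Relation.Nullary using (¬_)
open import Relation.Binary.Core using (Rel)
open import Algebra.Core using (Op₁; Op₂)
open import Algebra.Definitions using (Identity; Congruent₁)
open import Algebra.Lattice.Structures using (IsDistributiveLattice)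

record DeMorganAlgebra (c ℓ : Level) : Set (suc (c ⊔ ℓ)) where
  infixr 7 _∧_
  infixr 6 _∨_
  field
    Carrier : Set c
    _≈_     : Rel Carrier ℓ
    _∨_     : Op₂ Carrier
    _∧_     : Op₂ Carrier
    𝟘       : Carrier
    𝟙       : Carrier
    neg     : Op₁ Carrier
    isDistributiveLattice : IsDistributiveLattice _≈_ _∨_ _∧_
    ∨-identity : Identity _≈_ 𝟘 _∨_
    ∧-identity : Identity _≈_ 𝟙 _∧_
    neg-cong   : Congruent₁ _≈_ neg
    neg-invol  : ∀ x → neg (neg x) ≈ x
    deMorgan-∨ : ∀ x y → neg (x ∨ y) ≈ (neg x ∧ neg y)
    deMorgan-∧ : ∀ x y → neg (x ∧ y) ≈ (neg x ∨ neg y)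

  open IsDistributiveLattice isDistributiveLattice public

data FPIL (P : Set) : Set where
  true : FPIL P
  port : P → FPIL P
  !_   : FPIL P → FPIL P
  _⊔ᶠ_ : FPIL P → FPIL P → FPIL P

data FPCL (P : Set) : Set where
  pil  : FPIL P → FPCL P
  ¬ᶜ_  : FPCL P → FPCL P
  _⊕_  : FPCL P → FPCL P → FPCL P
  _⊎ᶜ_ : FPCL P → FPCL P → FPCL P

∼_ : {P : Set} → FPCL P → FPCL P
∼ ζ = ζ ⊎ᶜ pil true

module Semantics {c ℓ : Level} (K : DeMorganAlgebra c ℓ) (P : Set) where
  open DeMorganAlgebra K

  record Interaction : Set (c ⊔ ℓ) where
    field
      fn      : P → Carrier
      nonzero : ∃ λ p → ¬ (fn p ≈ 𝟘)
  open Interaction public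

  ⟦_⟧ᵢ : FPIL P → Interaction → Carrier
  ⟦ true ⟧ᵢ     α = 𝟙
  ⟦ port p ⟧ᵢ   α = fn α p
  ⟦ ! φ ⟧ᵢ      α = neg (⟦ φ ⟧ᵢ α)
  ⟦ φ ⊔ᶠ ψ ⟧ᵢ   α = ⟦ φ ⟧ᵢ α ∨ ⟦ ψ ⟧ᵢ α

  -- A configuration γ ∈ fC(P,K) is represented by a (nonempty) finite
  -- list of interactions; only nonempty lists are ever evaluated in
  -- the main statement.  Ways of writing γ = γ₁ ∪ γ₂: each entry goes to
  -- γ₁ only, to γ₂ only, or to both.
  covers : List Interaction → List (List Interaction × List Interaction)
  covers []       = ([] , []) ∷ []
  covers (x ∷ xs) =
    concatMap (λ { (l , r) → (x ∷ l , r) ∷ (l , x ∷ r) ∷ (x ∷ l , x ∷ r) ∷ [] })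
              (covers xs)

  ⟦_⟧ : FPCL P → List Interaction → Carrier
  ⟦ pil φ ⟧  γ = foldr (λ α acc → ⟦ φ ⟧ᵢ α ∧ acc) 𝟙 γ
  ⟦ ¬ᶜ ζ ⟧   γ = neg (⟦ ζ ⟧ γ)
  ⟦ ζ ⊕ ξ ⟧  γ = ⟦ ζ ⟧ γ ∨ ⟦ ξ ⟧ γ
  ⟦ ζ ⊎ᶜ ξ ⟧ γ = foldr _∨_ 𝟘 (map term (covers γ))
    where
      -- only pairs of nonempty configurations γ₁, γ₂ ∈ fC(P,K) count
      term : List Interaction × List Interaction → Carrier
      term ([]    , _)     = 𝟘
      term (_ ∷ _ , [])    = 𝟘
      term (l@(_ ∷ _) , r@(_ ∷ _)) = ⟦ ζ ⟧ l ∧ ⟦ ξ ⟧ r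

  _≡ᶜ_ : FPCL P → FPCL P → Set (c ⊔ ℓ)
  ζ ≡ᶜ ξ = ∀ (α : Interaction) (αs : List Interaction) →
           ⟦ ζ ⟧ (α ∷ αs) ≈ ⟦ ξ ⟧ (α ∷ αs)

-- On a configuration γ, an fPIL formula φ denotes the meet of ⟦ φ ⟧ᵢ over γ,
-- and ∼ φ = φ ⊎ true denotes the join of ⟦ φ ⟧ᵢ over γ: a split γ₁ ∪ γ₂ = γ
-- contributes at most ⟦ φ ⟧ᵢ of any element of γ₁, and the split {α} ∪ γ
-- contributes exactly ⟦ φ ⟧ᵢ α.  Parts (2) and (3) are then the De Morgan laws
-- for finite joins and meets.  For (1), every split satisfies
-- ⋀ γ₁ ∧ ⋀ γ₂ ≤ ⋀ γ, with equality for the split γ ∪ γ.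
module Submission where

open import Level using (Level)
open import Function using (_∘_)
open import Data.Product using (_×_; _,_; proj₁; proj₂)
open import Data.Sum using (_⊎_; inj₁; inj₂)
import Data.Sum as Sum
open import Data.List using (List; []; _∷_; [_]; foldr; map)
open import Data.List.Relation.Unary.Any using (here; there)
open import Data.List.Membership.Propositional using (_∈_; find; lose)
open import Data.List.Membership.Propositional.Properties using (∈-concatMap⁺; ∈-concatMap⁻)
open import Data.List.Relation.Binary.Subset.Propositional using (_⊆_)
open import Relation.Binary.PropositionalEquality using (refl)
open import Algebra.Lattice.Bundles using (Lattice)
open import Algebra.Lattice.Properties.Lattice using (∨-∧-orderTheoreticLattice)
import Relation.Binary.Lattice as Order
open import Defs

module _ {a : Level} {A : Set a} where

  data Cover : List A → List A → List A → Set a where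
    []    : Cover [] [] []
    left  : ∀ {x xs l r} → Cover xs l r → Cover (x ∷ xs) (x ∷ l) r
    right : ∀ {x xs l r} → Cover xs l r → Cover (x ∷ xs) l (x ∷ r)
    both  : ∀ {x xs l r} → Cover xs l r → Cover (x ∷ xs) (x ∷ l) (x ∷ r)

  Cover-⊆-∪ : ∀ {xs l r} → Cover xs l r → ∀ {x} → x ∈ xs → x ∈ l ⊎ x ∈ r
  Cover-⊆-∪ (left  c) (here refl) = inj₁ (here refl)
  Cover-⊆-∪ (right c) (here refl) = inj₂ (here refl)
  Cover-⊆-∪ (both  c) (here refl) = inj₁ (here refl)
  Cover-⊆-∪ (left  c) (there x∈xs) = Sum.map₁ there (Cover-⊆-∪ c x∈xs)
  Cover-⊆-∪ (right c) (there x∈xs) = Sum.map₂ there (Cover-⊆-∪ c x∈xs)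
  Cover-⊆-∪ (both  c) (there x∈xs) = Sum.map there there (Cover-⊆-∪ c x∈xs)

  Cover-⊆ˡ : ∀ {xs l r} → Cover xs l r → l ⊆ xs
  Cover-⊆ˡ (left  c) (here refl)  = here refl
  Cover-⊆ˡ (left  c) (there x∈l)  = there (Cover-⊆ˡ c x∈l)
  Cover-⊆ˡ (right c) x∈l          = there (Cover-⊆ˡ c x∈l)
  Cover-⊆ˡ (both  c) (here refl)  = here refl
  Cover-⊆ˡ (both  c) (there x∈l)  = there (Cover-⊆ˡ c x∈l)

  Cover-diagonal : ∀ xs → Cover xs xs xs
  Cover-diagonal []       = []
  Cover-diagonal (x ∷ xs) = both (Cover-diagonal xs)

  Cover-emptyˡ : ∀ xs → Cover xs [] xs
  Cover-emptyˡ []       = []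
  Cover-emptyˡ (x ∷ xs) = right (Cover-emptyˡ xs)

  Cover-singletonˡ : ∀ {xs x} → x ∈ xs → Cover xs [ x ] xs
  Cover-singletonˡ {_ ∷ xs} (here refl)  = both (Cover-emptyˡ xs)
  Cover-singletonˡ          (there x∈xs) = right (Cover-singletonˡ x∈xs)

module DeMorganAlgebraProperties {c ℓ : Level} (K : DeMorganAlgebra c ℓ) where
  open DeMorganAlgebra K hiding (refl)

  lattice : Lattice c ℓ
  lattice = record { isLattice = isLattice }

  open Order.Lattice (∨-∧-orderTheoreticLattice lattice) public
    using (_≤_; antisym; x≤x∨y; y≤x∨y; ∨-least; x∧y≤x; x∧y≤y; ∧-greatest)
    renaming (refl to ≤-refl; trans to ≤-trans; reflexive to ≤-reflexive)

  𝟘-minimum : ∀ x → 𝟘 ≤ x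
  𝟘-minimum x = sym (trans (∧-congˡ (sym (proj₁ ∨-identity x))) (∧-absorbs-∨ 𝟘 x))

  𝟙-maximum : ∀ x → x ≤ 𝟙
  𝟙-maximum x = sym (proj₂ ∧-identity x)

  neg-antitone : ∀ {x y} → x ≤ y → neg y ≤ neg x
  neg-antitone {x} {y} x≈x∧y = ≤-trans (y≤x∨y (neg x) (neg y)) (≤-reflexive (begin
    neg x ∨ neg y  ≈⟨ deMorgan-∧ x y ⟨
    neg (x ∧ y)    ≈⟨ neg-cong x≈x∧y ⟨
    neg x          ∎))
    where open import Relation.Binary.Reasoning.Setoid (Lattice.setoid lattice)

  neg-𝟘 : neg 𝟘 ≈ 𝟙
  neg-𝟘 = antisym (𝟙-maximum (neg 𝟘))
    (≤-trans (≤-reflexive (sym (neg-invol 𝟙))) (neg-antitone (𝟘-minimum (neg 𝟙))))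

  neg-𝟙 : neg 𝟙 ≈ 𝟘
  neg-𝟙 = trans (neg-cong (sym neg-𝟘)) (neg-invol 𝟘)

  module _ {a : Level} {A : Set a} where

    ⋁ : (A → Carrier) → List A → Carrier
    ⋁ f xs = foldr _∨_ 𝟘 (map f xs)

    ⋀ : (A → Carrier) → List A → Carrier
    ⋀ f xs = foldr (λ x acc → f x ∧ acc) 𝟙 xs

    ≤-⋁ : ∀ f {x} {xs} → x ∈ xs → f x ≤ ⋁ f xs
    ≤-⋁ f (here refl) = x≤x∨y _ _
    ≤-⋁ f (there x∈xs) = ≤-trans (≤-⋁ f x∈xs) (y≤x∨y _ _)

    ⋁-least : ∀ {f} xs {u} → (∀ {x} → x ∈ xs → f x ≤ u) → ⋁ f xs ≤ u
    ⋁-least []       {u} _     = 𝟘-minimum u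
    ⋁-least (x ∷ xs)     upper = ∨-least (upper (here refl)) (⋁-least xs (upper ∘ there))

    ⋀-≤ : ∀ f {x} {xs} → x ∈ xs → ⋀ f xs ≤ f x
    ⋀-≤ f (here refl) = x∧y≤x _ _
    ⋀-≤ f (there x∈xs) = ≤-trans (x∧y≤y _ _) (⋀-≤ f x∈xs)

    ⋀-greatest : ∀ {f} xs {u} → (∀ {x} → x ∈ xs → u ≤ f x) → u ≤ ⋀ f xs
    ⋀-greatest []       {u} _     = 𝟙-maximum u
    ⋀-greatest (x ∷ xs)     lower = ∧-greatest (lower (here refl)) (⋀-greatest xs (lower ∘ there))

    ⋀-∧-⋀-≤-⋀ : ∀ f xs ys {zs} → (∀ {z} → z ∈ zs → z ∈ xs ⊎ z ∈ ys) →
                ⋀ f xs ∧ ⋀ f ys ≤ ⋀ f zs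
    ⋀-∧-⋀-≤-⋀ f xs ys {zs} zs⊆xs∪ys = ⋀-greatest zs bound
      where
      bound : ∀ {z} → z ∈ zs → ⋀ f xs ∧ ⋀ f ys ≤ f z
      bound z∈zs with zs⊆xs∪ys z∈zs
      ... | inj₁ z∈xs = ≤-trans (x∧y≤x _ _) (⋀-≤ f z∈xs)
      ... | inj₂ z∈ys = ≤-trans (x∧y≤y _ _) (⋀-≤ f z∈ys)

    neg-⋁ : ∀ f xs → neg (⋁ f xs) ≈ ⋀ (neg ∘ f) xs
    neg-⋁ f []       = neg-𝟘
    neg-⋁ f (x ∷ xs) = trans (deMorgan-∨ _ _) (∧-congˡ (neg-⋁ f xs))

    neg-⋀ : ∀ f xs → neg (⋀ f xs) ≈ ⋁ (neg ∘ f) xs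
    neg-⋀ f []       = neg-𝟙
    neg-⋀ f (x ∷ xs) = trans (deMorgan-∧ _ _) (∨-congˡ (neg-⋀ f xs))

module SemanticsProperties {c ℓ : Level} (K : DeMorganAlgebra c ℓ) (P : Set) where
  open DeMorganAlgebra K hiding (refl)
  open DeMorganAlgebraProperties K
  open Semantics K P

  extensions : Interaction → List Interaction × List Interaction →
               List (List Interaction × List Interaction)
  extensions x (l , r) = (x ∷ l , r) ∷ (l , x ∷ r) ∷ (x ∷ l , x ∷ r) ∷ []

  ∈-covers⁻ : ∀ {γ l r} → (l , r) ∈ covers γ → Cover γ l r
  ∈-covers⁻ {[]}    (here refl) = []
  ∈-covers⁻ {x ∷ xs} m with find (∈-concatMap⁻ (extensions x) {covers xs} m)
  ... | _ , m′ , here refl                 = left  (∈-covers⁻ m′)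
  ... | _ , m′ , there (here refl)         = right (∈-covers⁻ m′)
  ... | _ , m′ , there (there (here refl)) = both  (∈-covers⁻ m′)

  ∈-covers⁺ : ∀ {γ l r} → Cover γ l r → (l , r) ∈ covers γ
  ∈-covers⁺ []        = here refl
  ∈-covers⁺ (left  c) = ∈-concatMap⁺ (extensions _) (lose (∈-covers⁺ c) (here refl))
  ∈-covers⁺ (right c) = ∈-concatMap⁺ (extensions _) (lose (∈-covers⁺ c) (there (here refl)))
  ∈-covers⁺ (both  c) = ∈-concatMap⁺ (extensions _) (lose (∈-covers⁺ c) (there (there (here refl))))

  ⊎ᶜ-least : ∀ ζ ξ γ {u} →
             (∀ {a l b r} → Cover γ (a ∷ l) (b ∷ r) → ⟦ ζ ⟧ (a ∷ l) ∧ ⟦ ξ ⟧ (b ∷ r) ≤ u) →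
             ⟦ ζ ⊎ᶜ ξ ⟧ γ ≤ u
  ⊎ᶜ-least ζ ξ γ bound = ⋁-least (covers γ) λ
    { {[]    , _}     _ → 𝟘-minimum _
    ; {_ ∷ _ , []}    _ → 𝟘-minimum _
    ; {_ ∷ _ , _ ∷ _} m → bound (∈-covers⁻ m)
    }

  ≤-⊎ᶜ : ∀ ζ ξ {γ a l b r} → Cover γ (a ∷ l) (b ∷ r) →
         ⟦ ζ ⟧ (a ∷ l) ∧ ⟦ ξ ⟧ (b ∷ r) ≤ ⟦ ζ ⊎ᶜ ξ ⟧ γ
  ≤-⊎ᶜ ζ ξ c = ≤-⋁ _ (∈-covers⁺ c)

  ⊎ᶜ-idem-pil : ∀ φ → (pil φ ⊎ᶜ pil φ) ≡ᶜ pil φ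
  ⊎ᶜ-idem-pil φ α αs = antisym
    (⊎ᶜ-least (pil φ) (pil φ) γ λ c → ⋀-∧-⋀-≤-⋀ ⟦ φ ⟧ᵢ _ _ (Cover-⊆-∪ c))
    (≤-trans (∧-greatest ≤-refl ≤-refl) (≤-⊎ᶜ (pil φ) (pil φ) (Cover-diagonal γ)))
    where γ = α ∷ αs

  ∼pil≈⋁ : ∀ φ α αs → ⟦ ∼ pil φ ⟧ (α ∷ αs) ≈ ⋁ ⟦ φ ⟧ᵢ (α ∷ αs)
  ∼pil≈⋁ φ α αs = antisym
    (⊎ᶜ-least (pil φ) (pil true) γ λ c →
      ≤-trans (x∧y≤x _ _) (≤-trans (x∧y≤x _ _) (≤-⋁ ⟦ φ ⟧ᵢ (Cover-⊆ˡ c (here refl)))))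
    (⋁-least γ λ a∈γ → ≤-trans (singleton-term _) (≤-⊎ᶜ (pil φ) (pil true) (Cover-singletonˡ a∈γ)))
    where
    γ = α ∷ αs
    singleton-term : ∀ a → ⟦ φ ⟧ᵢ a ≤ ⟦ pil φ ⟧ [ a ] ∧ ⟦ pil true ⟧ γ
    singleton-term a = ∧-greatest (∧-greatest ≤-refl (𝟙-maximum _)) (⋀-greatest γ λ _ → 𝟙-maximum _)

mainTheorem13 : ∀ {c ℓ : Level} (K : DeMorganAlgebra c ℓ) (P : Set) (φ : FPIL P) →
    let open Semantics K P in
    ((pil φ ⊎ᶜ pil φ) ≡ᶜ pil φ)
    × ((¬ᶜ (∼ (pil φ))) ≡ᶜ pil (! φ))
    × ((¬ᶜ (pil φ)) ≡ᶜ (∼ (pil (! φ))))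
mainTheorem13 K P φ =
  ⊎ᶜ-idem-pil φ ,
  (λ α αs → trans (neg-cong (∼pil≈⋁ φ α αs)) (neg-⋁ ⟦ φ ⟧ᵢ (α ∷ αs))) ,
  (λ α αs → trans (neg-⋀ ⟦ φ ⟧ᵢ (α ∷ αs)) (sym (∼pil≈⋁ (! φ) α αs)))
  where
  open DeMorganAlgebra K
  open DeMorganAlgebraProperties K
  open Semantics K P
  open SemanticsProperties K P
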